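{- Let $G$ be a finite simple graph with $p\ge1$ vertices and $q$ edges, and write $q=tp+t_0$ with $t$ a nonnegative integer and $0\le t_0\le p-1$. Suppose $\lambda(\mathcal{D}[G])=2\lambda(G)$. Then $\mathcal{D}[G]$ is max-$\lambda$ if and only if $G$ is max-$\lambda$ and either $0\le t_0<\frac{p}{4}$ or $\frac{p}{2}\le t_0<\frac{3p}{4}$.
   Context: The total graph $T_2$ is $K_2$ with a loop added at each of its two vertices. The double graph is $\mathcal{D}[G]=G\times T_2$ (Kronecker product): it has vertex set $V(G)\times\{0,1\}$ and $(u,i)$ is adjacent to $(v,j)$ iff $uv\in E(G)$. For a graph $H$ with $p(H)\ge1$ vertices and $q(H)$ edges, $H$ is called max-$\lambda$ if $\lambda(H)=\lfloor 2q(H)/p(H)\rfloor$, where $\lambda$ is edge-connectivity. -}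

module Defs where

open import Data.Nat using (ℕ; zero; suc; _+_; _*_; _≤_; _<_; NonZero)
open import Data.Nat.DivMod using (_/_; _%_)
open import Data.Bool using (Bool; true; false; _∧_; not; if_then_else_)
open import Data.Fin using (Fin; toℕ; splitAt)
open import Data.Fin.Properties using ()
open import Data.Sum using (_⊎_; [_,_])
open import Data.Product using (Σ; _×_; ∃)
open import Data.List using (List; map; allFin)
open import Data.Nat.ListAction using (sum)
open import Relation.Binary.PropositionalEquality using (_≡_)
open import Relation.Nullary using (¬_)
open import Function using (id)

record Graph (n : ℕ) : Set where
  field
    adj    : Fin n → Fin n → Bool
    sym    : ∀ u v → adj u v ≡ adj v u
    irrefl : ∀ u → adj u u ≡ false
open Graph public

pairCount : ∀ {n} → (Fin n → Fin n → Bool) → ℕ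
pairCount {n} R =
  sum (map (λ u → sum (map (λ v → if (R u v ∧ (toℕ u Data.Nat.<ᵇ toℕ v)) then 1 else 0)
                             (allFin n)))
           (allFin n))

edges : ∀ {n} → Graph n → ℕ
edges G = pairCount (adj G)

data Reach {n : ℕ} (A : Fin n → Fin n → Bool) : Fin n → Fin n → Set where
  here  : ∀ {u} → Reach A u u
  there : ∀ {u w v} → A u w ≡ true → Reach A w v → Reach A u v

Connected : ∀ {n} → (Fin n → Fin n → Bool) → Set
Connected A = ∀ u v → Reach A u v

DisconnectedOrTrivial : ∀ {n} → (Fin n → Fin n → Bool) → Set
DisconnectedOrTrivial {n} A = (n ≤ 1) ⊎ ¬ Connected A

IsEdgeSet : ∀ {n} → Graph n → (Fin n → Fin n → Bool) → Set
IsEdgeSet G F = (∀ u v → F u v ≡ F v u) × (∀ u v → F u v ≡ true → adj G u v ≡ true)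

remove : ∀ {n} → Graph n → (Fin n → Fin n → Bool) → Fin n → Fin n → Bool
remove G F u v = adj G u v ∧ not (F u v)

EdgeConn : ∀ {n} → Graph n → ℕ → Set
EdgeConn G k =
  (Σ _ λ F → IsEdgeSet G F × pairCount F ≡ k × DisconnectedOrTrivial (remove G F))
  × (∀ F → IsEdgeSet G F → DisconnectedOrTrivial (remove G F) → k ≤ pairCount F)

MaxLambda : ∀ {n} → .{{NonZero n}} → Graph n → Set
MaxLambda {n} H = EdgeConn H ((2 * edges H) / n)

-- the double graph D[G] = G × T₂, vertex set Fin (n + n) ≅ V(G) × {0,1}
proj : ∀ {n} → Fin (n + n) → Fin n
proj {n} x = [ id , id ] (splitAt n x)

double : ∀ {n} → Graph n → Graph (n + n)
double G = record
  { adj    = λ x y → adj G (proj x) (proj y)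
  ; sym    = λ x y → sym G (proj x) (proj y)
  ; irrefl = λ x → irrefl G (proj x)
  }

t₀ : ∀ {n} → .{{NonZero n}} → Graph n → ℕ
t₀ {n} G = edges G % n

-- Every edge uv of G gives the four edges (u,i)(v,j) of D[G], and D[G] has
-- twice as many vertices, so ⌊2q(D[G])/p(D[G])⌋ = ⌊4q/p⌋. With λ(D[G]) = 2λ(G), D[G] is
-- max-λ iff 2λ(G) = ⌊4q/p⌋. Since ⌊2q/p⌋ = ⌊⌊4q/p⌋/2⌋, this holds iff λ(G) = ⌊2q/p⌋ and
-- ⌊4q/p⌋ is even; and ⌊4q/p⌋ ≡ ⌊4t₀/p⌋ (mod 2) with ⌊4t₀/p⌋ ∈ {0,1,2,3}, which is even
-- exactly in the two stated ranges of t₀.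
module Submission where

open import Defs
open import Data.Nat using (ℕ; zero; suc; _+_; _*_; _≤_; _<_; _<ᵇ_; NonZero; s≤s⁻¹)
open import Data.Nat.Properties
open import Data.Nat.DivMod
open import Data.Nat.Divisibility using (divides-refl; n∣m*n*o)
import Data.Nat.ListAction as List
open import Algebra.Properties.Semiring.Sum +-*-semiring
  using (sum; sum-syntax; ∑-distrib-+; ∑-comm; sum-cong-≗; *-distribˡ-sum)
open import Data.Bool using (Bool; true; false; _∧_; if_then_else_)
open import Data.Bool.Properties using (∧-identityʳ; ∧-zeroʳ; T-≡; ¬-not)
open import Data.Fin using (Fin; toℕ; _↑ˡ_; _↑ʳ_) renaming (zero to fzero; suc to fsuc)
open import Data.Fin.Properties using (splitAt-↑ˡ; splitAt-↑ʳ; toℕ-injective)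
open import Data.List using (allFin; map; tabulate)
open import Data.List.Properties using (map-tabulate; map-cong)
open import Data.Product using (_×_; _,_)
open import Data.Product.Function.NonDependent.Propositional using (_×-⇔_)
open import Data.Sum using (_⊎_; inj₁; inj₂)
open import Function using (_∘_; id)
open import Function.Bundles using (_⇔_; mk⇔; Equivalence)
import Function.Properties.Equivalence as Eqv
open import Level using (0ℓ)
open import Relation.Binary using (tri<; tri≈; tri>)
import Relation.Binary.Reasoning.Setoid
open import Relation.Binary.PropositionalEquality as ≡
  using (_≡_; refl; cong; cong₂; trans; module ≡-Reasoning)
open import Relation.Nullary using (yes; no; contradiction)

module ⇔-Reasoning = Relation.Binary.Reasoning.Setoid (Eqv.⇔-setoid 0ℓ)

m/n≡j : ∀ {m n} j .{{_ : NonZero n}} → j * n ≤ m → m < suc j * n → m / n ≡ j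
m/n≡j {m} {n} j lo hi = ≤-antisym (s≤s⁻¹ (m<n*o⇒m/o<n hi))
  (≡.subst (_≤ m / n) (m*n/n≡m j n) (/-monoˡ-≤ n lo))

[k*m]/n≡k*[m/n]+[k*[m%n]]/n : ∀ k m n .{{_ : NonZero n}} →
  (k * m) / n ≡ k * (m / n) + (k * (m % n)) / n
[k*m]/n≡k*[m/n]+[k*[m%n]]/n k m n = begin
  (k * m) / n                                   ≡⟨ /-congˡ (cong (k *_) (m≡m%n+[m/n]*n m n)) ⟩
  (k * (m % n + m / n * n)) / n                  ≡⟨ /-congˡ (*-distribˡ-+ k (m % n) (m / n * n)) ⟩
  (k * (m % n) + k * (m / n * n)) / n            ≡⟨ /-congˡ (cong (k * (m % n) +_) (*-assoc k (m / n) n)) ⟨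
  (k * (m % n) + k * (m / n) * n) / n            ≡⟨ +-distrib-/-∣ʳ (k * (m % n)) (divides-refl (k * (m / n))) ⟩
  (k * (m % n)) / n + (k * (m / n) * n) / n      ≡⟨ cong ((k * (m % n)) / n +_) (m*n/n≡m (k * (m / n)) n) ⟩
  (k * (m % n)) / n + k * (m / n)                ≡⟨ +-comm ((k * (m % n)) / n) (k * (m / n)) ⟩
  k * (m / n) + (k * (m % n)) / n                ∎
  where open ≡-Reasoning

[k*m/n]/k≡m/n : ∀ k m n .{{_ : NonZero k}} .{{_ : NonZero n}} → ((k * m) / n) / k ≡ m / n
[k*m/n]/k≡m/n k m n = begin
  ((k * m) / n) / k   ≡⟨ m/n/o≡m/[n*o] (k * m) n k ⟩
  (k * m) / (n * k)   ≡⟨ /-congʳ (*-comm n k) ⟩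
  (k * m) / (k * n)   ≡⟨ m*n/m*o≡n/o k m n ⟩
  m / n               ∎
  where
  open ≡-Reasoning
  instance
    n*k≢0 : NonZero (n * k)
    n*k≢0 = m*n≢0 n k
    k*n≢0 : NonZero (k * n)
    k*n≢0 = m*n≢0 k n

2*m≡n⇔m≡n/2×n%2≡0 : ∀ {m n} → (2 * m ≡ n) ⇔ ((m ≡ n / 2) × (n % 2 ≡ 0))
2*m≡n⇔m≡n/2×n%2≡0 {m} {n} = mk⇔
  (λ { refl → ≡.sym (≡.subst (λ k → k / 2 ≡ m) (*-comm m 2) (m*n/n≡m m 2))
            , ≡.subst (λ k → k % 2 ≡ 0) (*-comm m 2) (m*n%n≡0 m 2) })
  (λ { (m≡n/2 , n%2≡0) → begin
         2 * m           ≡⟨ *-comm 2 m ⟩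
         m * 2           ≡⟨ cong (_* 2) m≡n/2 ⟩
         n / 2 * 2       ≡⟨ cong (_+ n / 2 * 2) n%2≡0 ⟨
         n % 2 + n / 2 * 2 ≡⟨ m≡m%n+[m/n]*n n 2 ⟨
         n               ∎ })
  where open ≡-Reasoning

-- t₀ < p/4, or p/2 ≤ t₀ < 3p/4, cleared of denominators.
QuarterCondition : ℕ → ℕ → Set
QuarterCondition p x = (4 * x < p) ⊎ ((p ≤ 2 * x) × (4 * x < 3 * p))

[4x/p]%2≡0⇔QuarterCondition : ∀ {p x} .{{_ : NonZero p}} → x < p →
  ((4 * x) / p % 2 ≡ 0) ⇔ QuarterCondition p x
[4x/p]%2≡0⇔QuarterCondition {p} {x} x<p with 4 * x <? p | 4 * x <? 2 * p | 4 * x <? 3 * p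
... | yes 4x<p | _ | _ = mk⇔ (λ _ → inj₁ 4x<p) (λ _ → cong (_% 2) (m<n⇒m/n≡0 4x<p))
... | no 4x≮p | yes 4x<2p | _ =
  mk⇔ (λ even → contradiction (≡.subst (λ k → k % 2 ≡ 0) q≡1 even) λ ()) excluded
  where
  q≡1 = m/n≡j 1 (≡.subst (_≤ 4 * x) (≡.sym (*-identityˡ p)) (≮⇒≥ 4x≮p)) 4x<2p
  excluded : QuarterCondition p x → (4 * x) / p % 2 ≡ 0
  excluded (inj₁ 4x<p) = contradiction 4x<p 4x≮p
  excluded (inj₂ (p≤2x , _)) =
    contradiction 4x<2p (≤⇒≯ (≡.subst (2 * p ≤_) (≡.sym (*-assoc 2 2 x)) (*-monoʳ-≤ 2 p≤2x)))
... | no 4x≮p | no 4x≮2p | yes 4x<3p = mk⇔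
  (λ _ → inj₂ (*-cancelˡ-≤ 2 (≡.subst (2 * p ≤_) (*-assoc 2 2 x) (≮⇒≥ 4x≮2p)) , 4x<3p))
  (λ _ → cong (_% 2) (m/n≡j 2 (≮⇒≥ 4x≮2p) 4x<3p))
... | no 4x≮p | no _ | no 4x≮3p =
  mk⇔ (λ even → contradiction (≡.subst (λ k → k % 2 ≡ 0) q≡3 even) λ ()) excluded
  where
  q≡3 = m/n≡j 3 (≮⇒≥ 4x≮3p) (*-monoʳ-< 4 x<p)
  excluded : QuarterCondition p x → (4 * x) / p % 2 ≡ 0
  excluded (inj₁ 4x<p) = contradiction 4x<p 4x≮p
  excluded (inj₂ (_ , 4x<3p)) = contradiction 4x<3p 4x≮3p

[4m/n]%2≡[4[m%n]/n]%2 : ∀ m n .{{_ : NonZero n}} → (4 * m) / n % 2 ≡ (4 * (m % n)) / n % 2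
[4m/n]%2≡[4[m%n]/n]%2 m n = trans (cong (_% 2) ([k*m]/n≡k*[m/n]+[k*[m%n]]/n 4 m n))
                                  (%-remove-+ˡ ((4 * (m % n)) / n) (n∣m*n*o 2 (m / n)))

2*l≡[4m/n]⇔l≡[2m/n]×QuarterCondition : ∀ l m n .{{_ : NonZero n}} →
  (2 * l ≡ (4 * m) / n) ⇔ ((l ≡ (2 * m) / n) × QuarterCondition n (m % n))
2*l≡[4m/n]⇔l≡[2m/n]×QuarterCondition l m n = begin
  (2 * l ≡ (4 * m) / n)                                     ≈⟨ 2*m≡n⇔m≡n/2×n%2≡0 ⟩
  ((l ≡ (4 * m) / n / 2) × ((4 * m) / n % 2 ≡ 0))           ≡⟨ cong₂ (λ a b → (l ≡ a) × (b ≡ 0)) half ([4m/n]%2≡[4[m%n]/n]%2 m n) ⟩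
  ((l ≡ (2 * m) / n) × ((4 * (m % n)) / n % 2 ≡ 0))         ≈⟨ Eqv.refl ×-⇔ [4x/p]%2≡0⇔QuarterCondition (m%n<n m n) ⟩
  ((l ≡ (2 * m) / n) × QuarterCondition n (m % n))          ∎
  where
  open ⇔-Reasoning
  half : (4 * m) / n / 2 ≡ (2 * m) / n
  half = trans (cong (λ k → k / n / 2) (*-assoc 2 2 m)) ([k*m/n]/k≡m/n 2 (2 * m) n)

𝟙 : Bool → ℕ
𝟙 b = if b then 1 else 0

sum-map-allFin : ∀ n (f : Fin n → ℕ) → List.sum (map f (allFin n)) ≡ sum f
sum-map-allFin zero    f = refl
sum-map-allFin (suc n) f = cong (f fzero +_) (begin
  List.sum (map f (tabulate fsuc))       ≡⟨ cong List.sum (map-tabulate fsuc f) ⟩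
  List.sum (tabulate (f ∘ fsuc))         ≡⟨ cong List.sum (map-tabulate id (f ∘ fsuc)) ⟨
  List.sum (map (f ∘ fsuc) (allFin n))   ≡⟨ sum-map-allFin n (f ∘ fsuc) ⟩
  sum (f ∘ fsuc)                         ∎)
  where open ≡-Reasoning

∑-splitAt : ∀ m k (f : Fin (m + k) → ℕ) →
       sum f ≡ ∑[ i < m ] f (i ↑ˡ k) + ∑[ j < k ] f (m ↑ʳ j)
∑-splitAt zero    k f = refl
∑-splitAt (suc m) k f = trans (cong (f fzero +_) (∑-splitAt m k (f ∘ fsuc))) (≡.sym (+-assoc (f fzero) _ _))

proj-↑ˡ : ∀ {m} (u : Fin m) → proj (u ↑ˡ m) ≡ u
proj-↑ˡ {m} u rewrite splitAt-↑ˡ m u m = refl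

proj-↑ʳ : ∀ {m} (u : Fin m) → proj (m ↑ʳ u) ≡ u
proj-↑ʳ {m} u rewrite splitAt-↑ʳ m m u = refl

∑-proj : ∀ m (f : Fin m → ℕ) → ∑[ x < m + m ] f (proj x) ≡ 2 * sum f
∑-proj m f = begin
  ∑[ x < m + m ] f (proj x)                                        ≡⟨ ∑-splitAt m m (f ∘ proj) ⟩
  ∑[ u < m ] f (proj (u ↑ˡ m)) + ∑[ u < m ] f (proj (m ↑ʳ u))     ≡⟨ cong₂ _+_ (sum-cong-≗ (cong f ∘ proj-↑ˡ)) (sum-cong-≗ (cong f ∘ proj-↑ʳ)) ⟩
  sum f + sum f                                                    ≡⟨ cong (sum f +_) (≡.sym (+-identityʳ (sum f))) ⟩
  2 * sum f                                                        ∎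
  where open ≡-Reasoning

<⇒<ᵇ≡true : ∀ {m n} → m < n → (m <ᵇ n) ≡ true
<⇒<ᵇ≡true m<n = Equivalence.to T-≡ (<⇒<ᵇ m<n)

≥⇒<ᵇ≡false : ∀ {m n} → n ≤ m → (m <ᵇ n) ≡ false
≥⇒<ᵇ≡false {m} {n} n≤m = ¬-not (λ m<ᵇn → ≤⇒≯ n≤m (<ᵇ⇒< m n (Equivalence.from T-≡ m<ᵇn)))

pairCount-∑ : ∀ {n} (R : Fin n → Fin n → Bool) →
              pairCount R ≡ ∑[ u < n ] ∑[ v < n ] 𝟙 (R u v ∧ (toℕ u <ᵇ toℕ v))
pairCount-∑ {n} R =
  trans (cong List.sum (map-cong (λ u → sum-map-allFin n _) (allFin n))) (sum-map-allFin n _)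

degreeSum : ∀ {n} → Graph n → ℕ
degreeSum {n} G = ∑[ u < n ] ∑[ v < n ] 𝟙 (adj G u v)

module _ {n} (G : Graph n) where

  private
    upper : Fin n → Fin n → ℕ
    upper u v = 𝟙 (adj G u v ∧ (toℕ u <ᵇ toℕ v))

    adj-upper : ∀ u v → 𝟙 (adj G u v) ≡ upper u v + upper v u
    adj-upper u v with <-cmp (toℕ u) (toℕ v)
    ... | tri< u<v _ _
      rewrite <⇒<ᵇ≡true u<v | ≥⇒<ᵇ≡false {toℕ v} (<⇒≤ u<v) | ∧-identityʳ (adj G u v) | ∧-zeroʳ (adj G v u)
      = ≡.sym (+-identityʳ _)
    ... | tri> _ _ v<u
      rewrite <⇒<ᵇ≡true v<u | ≥⇒<ᵇ≡false {toℕ u} (<⇒≤ v<u) | ∧-identityʳ (adj G v u) | ∧-zeroʳ (adj G u v)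
      = cong 𝟙 (Graph.sym G u v)
    ... | tri≈ _ u≡v _ rewrite toℕ-injective u≡v | irrefl G v = refl

  handshake : degreeSum G ≡ 2 * edges G
  handshake = begin
    ∑[ u < n ] ∑[ v < n ] 𝟙 (adj G u v)                              ≡⟨ sum-cong-≗ (λ u → sum-cong-≗ (adj-upper u)) ⟩
    ∑[ u < n ] ∑[ v < n ] (upper u v + upper v u)                    ≡⟨ sum-cong-≗ (λ u → ∑-distrib-+ (upper u) (λ v → upper v u)) ⟩
    ∑[ u < n ] (∑[ v < n ] upper u v + ∑[ v < n ] upper v u)         ≡⟨ ∑-distrib-+ (λ u → ∑[ v < n ] upper u v) (λ u → ∑[ v < n ] upper v u) ⟩
    ∑[ u < n ] ∑[ v < n ] upper u v + ∑[ u < n ] ∑[ v < n ] upper v u ≡⟨ cong (e +_) (∑-comm (λ u v → upper v u)) ⟩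
    e + e                                                            ≡⟨ cong (e +_) (+-identityʳ e) ⟨
    2 * e                                                            ≡⟨ cong (2 *_) (pairCount-∑ (adj G)) ⟨
    2 * edges G                                                      ∎
    where
    open ≡-Reasoning
    e = ∑[ u < n ] ∑[ v < n ] upper u v

edges-double : ∀ {m} (G : Graph m) → edges (double G) ≡ 4 * edges G
edges-double {m} G = *-cancelˡ-≡ _ _ 2 (begin
  2 * edges (double G)                  ≡⟨ handshake (double G) ⟨
  degreeSum (double G)                  ≡⟨ sum-cong-≗ (λ x → ∑-proj m (adj-count (proj x))) ⟩
  ∑[ x < m + m ] (2 * degree (proj x))  ≡⟨ *-distribˡ-sum 2 (degree ∘ proj) ⟨
  2 * (∑[ x < m + m ] degree (proj x))  ≡⟨ cong (2 *_) (∑-proj m degree) ⟩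
  2 * (2 * degreeSum G)                 ≡⟨ cong (λ k → 2 * (2 * k)) (handshake G) ⟩
  2 * (2 * (2 * edges G))               ≡⟨ cong (2 *_) (*-assoc 2 2 (edges G)) ⟨
  2 * (4 * edges G)                     ∎)
  where
  open ≡-Reasoning
  adj-count : Fin m → Fin m → ℕ
  adj-count u v = 𝟙 (adj G u v)
  degree : Fin m → ℕ
  degree u = sum (adj-count u)

EdgeConn-unique : ∀ {m} {H : Graph m} {k k′} → EdgeConn H k → EdgeConn H k′ → k ≡ k′
EdgeConn-unique {k = k} {k′} ((F , F-edges , |F|≡k , F-cuts) , k-min)
                             ((F′ , F′-edges , |F′|≡k′ , F′-cuts) , k′-min) =
  ≤-antisym (≡.subst (k ≤_) |F′|≡k′ (k-min F′ F′-edges F′-cuts))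
            (≡.subst (k′ ≤_) |F|≡k (k′-min F F-edges F-cuts))

EdgeConn⇔≡ : ∀ {m} {H : Graph m} {k k′} → EdgeConn H k → EdgeConn H k′ ⇔ (k ≡ k′)
EdgeConn⇔≡ {H = H} λH = mk⇔ (EdgeConn-unique {H = H} λH) (λ k≡k′ → ≡.subst (EdgeConn H) k≡k′ λH)

maxλ-value-double : ∀ {n} (G : Graph (suc n)) →
  (2 * edges (double G)) / (suc n + suc n) ≡ (4 * edges G) / suc n
maxλ-value-double {n} G = begin
  (2 * edges (double G)) / (p + p)   ≡⟨ /-congˡ (cong (2 *_) (edges-double G)) ⟩
  (2 * (4 * edges G)) / (p + p)      ≡⟨ /-congʳ {m = 2 * (4 * edges G)} (cong (p +_) (+-identityʳ p)) ⟨
  (2 * (4 * edges G)) / (2 * p)      ≡⟨ m*n/m*o≡n/o 2 (4 * edges G) p ⟩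
  (4 * edges G) / p                  ∎
  where
  open ≡-Reasoning
  p = suc n

theorem3p8 : ∀ {n} (G : Graph (suc n)) (λG λD : ℕ) →
    EdgeConn G λG → EdgeConn (double G) λD → λD ≡ 2 * λG →
    (MaxLambda (double G) ⇔
      (MaxLambda G × ((4 * t₀ G < suc n) ⊎ ((suc n ≤ 2 * t₀ G) × (4 * t₀ G < 3 * suc n)))))
theorem3p8 {n} G λG λD λ[G] λ[DG] λD≡2λG = begin
  MaxLambda (double G)                                              ≈⟨ EdgeConn⇔≡ {H = double G} λ[DG] ⟩
  (λD ≡ (2 * edges (double G)) / (suc n + suc n))                   ≡⟨ cong₂ _≡_ λD≡2λG (maxλ-value-double G) ⟩
  (2 * λG ≡ (4 * edges G) / suc n)                                  ≈⟨ 2*l≡[4m/n]⇔l≡[2m/n]×QuarterCondition λG (edges G) (suc n) ⟩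
  ((λG ≡ (2 * edges G) / suc n) × QuarterCondition (suc n) (t₀ G))  ≈⟨ Eqv.sym (EdgeConn⇔≡ {H = G} λ[G]) ×-⇔ Eqv.refl ⟩
  (MaxLambda G × QuarterCondition (suc n) (t₀ G))                   ∎
  where open ⇔-Reasoning
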